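{- Let $p,q$ be positive integers and let $b_i=\binom{i+p-1}{q}$ for $i=1,2,\ldots$. Then there exist integers $m_0(p,q),m_1(p,q),\ldots,m_q(p,q)$, not depending on $n$, such that \[C^{(\mathbf b)}(n+q+1)=\sum_{i=0}^{q}m_i(p,q)\,C^{(\mathbf b)}(n+i)\quad\text{for all integers } n\ge2.\]
   Context: Given a sequence $\mathbf b=(b_1,b_2,\ldots)$ of nonnegative integers and positive integers $n,k$, $C^{(\mathbf b)}(n,k)=\sum b_{i_1}\cdots b_{i_k}$, the sum over all $k$-tuples of positive integers with sum $n$ (number of compositions of $n$ with $k$ parts where a part equal to $j$ comes in $b_j$ types), and $C^{(\mathbf b)}(n)=\sum_{k=1}^nC^{(\mathbf b)}(n,k)$ is the number of all such generalized compositions of $n$. Binomial coefficients $\binom{a}{b}$ are $0$ when $a<b$. -}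

module Defs where

open import Data.Nat using (ℕ; zero; suc; _+_; _*_; _∸_)
open import Data.Nat.Combinatorics using (_C_)
open import Data.List using (List; map; sum; upTo)

-- A sequence b = (b_1, b_2, ...) is represented as a function ℕ → ℕ;
-- the value at 0 is never used.

Σ₁ : ℕ → (ℕ → ℕ) → ℕ
Σ₁ zero    f = 0
Σ₁ (suc n) f = Σ₁ n f + f (suc n)

-- compC b n k = Σ over k-tuples (i_1,…,i_k) of positive integers with
-- i_1+…+i_k = n of b_{i_1}⋯b_{i_k}; defined by recursion on k, splitting
-- off the first part i_1 = j.
compC : (ℕ → ℕ) → ℕ → ℕ → ℕ
compC b zero    zero    = 1
compC b (suc n) zero    = 0
compC b n       (suc k) = Σ₁ n (λ j → b j * compC b (n ∸ j) k)

compAll : (ℕ → ℕ) → ℕ → ℕ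
compAll b n = Σ₁ n (λ k → compC b n k)

bPQ : ℕ → ℕ → ℕ → ℕ
bPQ p q i = (i + p ∸ 1) C q

module Submission where

-- Let b_j = binom(j+p-1, q) and let c(n) count all generalized compositions
-- of n, with the convention c(0) = 1 for the empty composition.
--
-- 1. Splitting off the first part gives the convolution identity
--    c(n) = Σ_{j=1}^{n} b_j c(n-j) for n ≥ 1.
-- 2. Put T_r(n) = Σ_{j=1}^{n} binom(j+p-1, r) c(n-j).  Pascal's rule gives
--    T_r(n+1) - T_r(n) = binom(p, r) c(n) + T_{r-1}(n)   (T_{-1} = 0),
--    while T_q(n) = c(n) for n ≥ 1 by step 1.  So, writing A(n) = c(n+1)
--    and U_r(n) = T_r(n+1), the forward difference Δ lowers U_r to U_{r-1}
--    up to a multiple of A.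
-- 3. Call a sequence "spanned of width k" if it is a fixed integer
--    combination of the window A(n), …, A(n+k-1).  By induction on r,
--    Δ^{r+1} U_r is spanned of width r+1, using that Δ^j A(n) is A(n+j)
--    plus a combination of width j.  For r = q this says Δ^{q+1} A is
--    spanned of width q+1, and solving for its leading term A(n+q+1) gives
--    the linear recurrence of order q+1, valid for all n ≥ 1.

open import Defs
open import Data.Nat using (ℕ; suc; _+_; _≤_)
open import Data.Integer using (ℤ; +_)
open import Data.Integer using () renaming (_+_ to _+ℤ_; _*_ to _*ℤ_)
open import Data.Fin using (Fin; toℕ)
open import Data.Product using (∃)
open import Relation.Binary.PropositionalEquality using (_≡_)
open import Data.Vec.Functional using (foldr)

open import Data.Nat using (zero; _*_; _∸_; _<_; z≤n; s≤s)
open import Data.Nat.Properties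
open import Data.Nat.Combinatorics using (_C_; nCk+nC[k+1]≡[n+1]C[k+1])
open import Data.Integer using () renaming (_-_ to _-ℤ_; -_ to -ℤ_)
import Data.Integer.Properties as ℤₚ
open import Data.Integer.Tactic.RingSolver using (solve-∀)
open import Data.Nat.Tactic.RingSolver using () renaming (solve-∀ to solve-∀ℕ)
open import Data.Fin using (zero; suc)
open import Data.Product using (_,_; proj₁; proj₂)
open import Relation.Binary.PropositionalEquality using (refl; sym; trans; cong; cong₂; module ≡-Reasoning)

Σ₁-cong : ∀ n {f g : ℕ → ℕ} → (∀ j → 1 ≤ j → j ≤ n → f j ≡ g j) → Σ₁ n f ≡ Σ₁ n g
Σ₁-cong zero    f≡g = refl
Σ₁-cong (suc n) f≡g =
  cong₂ _+_ (Σ₁-cong n (λ j 1≤j j≤n → f≡g j 1≤j (m≤n⇒m≤1+n j≤n))) (f≡g (suc n) (s≤s z≤n) ≤-refl)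

Σ₁-cong′ : ∀ n {f g : ℕ → ℕ} → (∀ j → f j ≡ g j) → Σ₁ n f ≡ Σ₁ n g
Σ₁-cong′ n f≡g = Σ₁-cong n (λ j _ _ → f≡g j)

Σ₁-zero : ∀ n → Σ₁ n (λ _ → 0) ≡ 0
Σ₁-zero zero    = refl
Σ₁-zero (suc n) = trans (+-identityʳ _) (Σ₁-zero n)

Σ₁-+ : ∀ n (f g : ℕ → ℕ) → Σ₁ n (λ j → f j + g j) ≡ Σ₁ n f + Σ₁ n g
Σ₁-+ zero    f g = refl
Σ₁-+ (suc n) f g = trans (cong (_+ (f (suc n) + g (suc n))) (Σ₁-+ n f g))
                           (interchange (Σ₁ n f) (Σ₁ n g) (f (suc n)) (g (suc n)))
  where
  interchange : ∀ a b c d → a + b + (c + d) ≡ a + c + (b + d)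
  interchange = solve-∀ℕ

Σ₁-*ˡ : ∀ n c (f : ℕ → ℕ) → Σ₁ n (λ j → c * f j) ≡ c * Σ₁ n f
Σ₁-*ˡ zero    c f = sym (*-zeroʳ c)
Σ₁-*ˡ (suc n) c f =
  trans (cong (_+ c * f (suc n)) (Σ₁-*ˡ n c f)) (sym (*-distribˡ-+ c (Σ₁ n f) (f (suc n))))

Σ₁-comm : ∀ K n (F : ℕ → ℕ → ℕ) →
          Σ₁ K (λ k → Σ₁ n (λ j → F j k)) ≡ Σ₁ n (λ j → Σ₁ K (λ k → F j k))
Σ₁-comm zero    n F = sym (Σ₁-zero n)
Σ₁-comm (suc K) n F =
  trans (cong (_+ Σ₁ n (λ j → F j (suc K))) (Σ₁-comm K n F))
        (sym (Σ₁-+ n (λ j → Σ₁ K (F j)) (λ j → F j (suc K))))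

Σ₁-peel : ∀ n (f : ℕ → ℕ) → Σ₁ (suc n) f ≡ f 1 + Σ₁ n (λ j → f (suc j))
Σ₁-peel zero    f = +-comm 0 (f 1)
Σ₁-peel (suc n) f = trans (cong (_+ f (suc (suc n))) (Σ₁-peel n f)) (+-assoc (f 1) _ _)

-- Step 1: the convolution identity for compositions.

module Compositions (b : ℕ → ℕ) where

  compC-suc : ∀ n k → compC b n (suc k) ≡ Σ₁ n (λ j → b j * compC b (n ∸ j) k)
  compC-suc zero    k = refl
  compC-suc (suc n) k = refl

  compC-vanish : ∀ k m → m < k → compC b m k ≡ 0
  compC-vanish (suc k) zero    _         = refl
  compC-vanish (suc k) (suc m) (s≤s m<k) =
    trans (Σ₁-cong (suc m) {g = λ _ → 0} vanishing-term) (Σ₁-zero (suc m))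
    where
    vanishing-term : ∀ j → 1 ≤ j → j ≤ suc m → b j * compC b (suc m ∸ j) k ≡ 0
    vanishing-term (suc j) _ _ =
      trans (cong (b (suc j) *_) (compC-vanish k (m ∸ j) (≤-<-trans (m∸n≤m m j) m<k)))
            (*-zeroʳ (b (suc j)))

  atMost : ℕ → ℕ → ℕ
  atMost m K = compC b m 0 + Σ₁ K (compC b m)

  -- Removing the first part j of a composition with at most K+1 parts
  -- leaves a composition of n-j with at most K parts.
  atMost-suc : ∀ n K → atMost n (suc K) ≡ compC b n 0 + Σ₁ n (λ j → b j * atMost (n ∸ j) K)
  atMost-suc n K = cong (_+_ (compC b n 0)) (begin
      Σ₁ (suc K) (compC b n)
    ≡⟨ Σ₁-peel K (compC b n) ⟩
      compC b n 1 + Σ₁ K (λ k → compC b n (suc k))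
    ≡⟨ cong₂ _+_ (compC-suc n 0) (Σ₁-cong′ K (compC-suc n)) ⟩
      Σ₁ n (λ j → b j * compC b (n ∸ j) 0) + Σ₁ K (λ k → Σ₁ n (λ j → b j * compC b (n ∸ j) k))
    ≡⟨ cong (_+_ (Σ₁ n (λ j → b j * compC b (n ∸ j) 0))) (Σ₁-comm K n (λ j k → b j * compC b (n ∸ j) k)) ⟩
      Σ₁ n (λ j → b j * compC b (n ∸ j) 0) + Σ₁ n (λ j → Σ₁ K (λ k → b j * compC b (n ∸ j) k))
    ≡⟨ cong (_+_ (Σ₁ n (λ j → b j * compC b (n ∸ j) 0))) (Σ₁-cong′ n (λ j → Σ₁-*ˡ K (b j) (compC b (n ∸ j)))) ⟩
      Σ₁ n (λ j → b j * compC b (n ∸ j) 0) + Σ₁ n (λ j → b j * Σ₁ K (compC b (n ∸ j)))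
    ≡⟨ sym (Σ₁-+ n _ _) ⟩
      Σ₁ n (λ j → b j * compC b (n ∸ j) 0 + b j * Σ₁ K (compC b (n ∸ j)))
    ≡⟨ Σ₁-cong′ n (λ j → sym (*-distribˡ-+ (b j) _ _)) ⟩
      Σ₁ n (λ j → b j * atMost (n ∸ j) K) ∎)
    where open ≡-Reasoning

  atMost-stable : ∀ m K → m ≤ K → atMost m K ≡ atMost m m
  atMost-stable m K m≤K = trans (cong (atMost m) (sym (m+[n∸m]≡n m≤K))) (beyond (K ∸ m))
    where
    beyond : ∀ d → atMost m (m + d) ≡ atMost m m
    beyond zero    = cong (atMost m) (+-identityʳ m)
    beyond (suc d) = begin
        compC b m 0 + Σ₁ (m + suc d) (compC b m)
      ≡⟨ cong (λ x → compC b m 0 + Σ₁ x (compC b m)) (+-suc m d) ⟩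
        compC b m 0 + (Σ₁ (m + d) (compC b m) + compC b m (suc (m + d)))
      ≡⟨ cong (λ x → compC b m 0 + (Σ₁ (m + d) (compC b m) + x))
              (compC-vanish (suc (m + d)) m (s≤s (m≤m+n m d))) ⟩
        compC b m 0 + (Σ₁ (m + d) (compC b m) + 0)
      ≡⟨ cong (_+_ (compC b m 0)) (+-identityʳ _) ⟩
        atMost m (m + d)
      ≡⟨ beyond d ⟩
        atMost m m ∎
      where open ≡-Reasoning

  -- c(m): all compositions of m, with c(0) = 1; c(n) = compAll b n for n ≥ 1.
  total : ℕ → ℕ
  total m = atMost m m

  total-conv : ∀ n → total (suc n) ≡ Σ₁ (suc n) (λ j → b j * total (suc n ∸ j))
  total-conv n = trans (atMost-suc (suc n) n) (Σ₁-cong (suc n) remainder-total)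
    where
    remainder-total : ∀ j → 1 ≤ j → j ≤ suc n → b j * atMost (suc n ∸ j) n ≡ b j * total (suc n ∸ j)
    remainder-total (suc j) _ _ = cong (b (suc j) *_) (atMost-stable (n ∸ j) n (m∸n≤m n j))

combo : ∀ k → (Fin k → ℤ) → (ℕ → ℤ) → ℤ
combo k L w = foldr _+ℤ_ (+ 0) (λ i → L i *ℤ w (toℕ i))

combo-cong : ∀ k L {w w′ : ℕ → ℤ} → (∀ i → w i ≡ w′ i) → combo k L w ≡ combo k L w′
combo-cong zero    L w≡w′ = refl
combo-cong (suc k) L w≡w′ =
  cong₂ _+ℤ_ (cong (L zero *ℤ_) (w≡w′ 0)) (combo-cong k (λ i → L (suc i)) (λ i → w≡w′ (suc i)))

combo-+ : ∀ k L M w → combo k (λ i → L i +ℤ M i) w ≡ combo k L w +ℤ combo k M w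
combo-+ zero    L M w = refl
combo-+ (suc k) L M w =
  trans (cong ((L zero +ℤ M zero) *ℤ w 0 +ℤ_) (combo-+ k (λ i → L (suc i)) (λ i → M (suc i)) (λ i → w (suc i))))
        (distribute (L zero) (M zero) (w 0) _ _)
  where
  distribute : ∀ (a b c x y : ℤ) → (a +ℤ b) *ℤ c +ℤ (x +ℤ y) ≡ (a *ℤ c +ℤ x) +ℤ (b *ℤ c +ℤ y)
  distribute = solve-∀

combo-scale : ∀ k c L w → combo k (λ i → c *ℤ L i) w ≡ c *ℤ combo k L w
combo-scale zero    c L w = sym (ℤₚ.*-zeroʳ c)
combo-scale (suc k) c L w =
  trans (cong ((c *ℤ L zero) *ℤ w 0 +ℤ_) (combo-scale k c (λ i → L (suc i)) (λ i → w (suc i))))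
        (factor c (L zero) (w 0) _)
  where
  factor : ∀ (c l x y : ℤ) → (c *ℤ l) *ℤ x +ℤ c *ℤ y ≡ c *ℤ (l *ℤ x +ℤ y)
  factor = solve-∀

padEnd : ∀ k → (Fin k → ℤ) → Fin (suc k) → ℤ
padEnd zero    L _       = + 0
padEnd (suc k) L zero    = L zero
padEnd (suc k) L (suc i) = padEnd k (λ i → L (suc i)) i

combo-padEnd : ∀ k L w → combo (suc k) (padEnd k L) w ≡ combo k L w
combo-padEnd zero    L w = ℤₚ.*-zeroˡ (w 0)
combo-padEnd (suc k) L w = cong (L zero *ℤ w 0 +ℤ_) (combo-padEnd k (λ i → L (suc i)) (λ i → w (suc i)))

padFront : ∀ k → (Fin k → ℤ) → Fin (suc k) → ℤ
padFront k L zero    = + 0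
padFront k L (suc i) = L i

combo-padFront : ∀ k L w → combo (suc k) (padFront k L) w ≡ combo k L (λ i → w (suc i))
combo-padFront k L w = trans (cong (_+ℤ combo k L (λ i → w (suc i))) (ℤₚ.*-zeroˡ (w 0))) (ℤₚ.+-identityˡ _)

-- Step 3: sequences spanned by a window of a fixed sequence A, and the
-- effect of forward differences on them.

module Windows (A : ℕ → ℤ) where

  Spanned : ℕ → (ℕ → ℤ) → Set
  Spanned k v = ∃ λ (L : Fin k → ℤ) → ∀ n → v n ≡ combo k L (λ i → A (n + i))

  span-cong : ∀ {k u v} → (∀ n → u n ≡ v n) → Spanned k u → Spanned k v
  span-cong u≡v (L , u≡) = L , λ n → trans (sym (u≡v n)) (u≡ n)

  span-zero : Spanned 0 (λ _ → + 0)
  span-zero = (λ ()) , λ n → refl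

  span-+ : ∀ {k u v} → Spanned k u → Spanned k v → Spanned k (λ n → u n +ℤ v n)
  span-+ {k} (L , u≡) (M , v≡) = (λ i → L i +ℤ M i) ,
    λ n → trans (cong₂ _+ℤ_ (u≡ n) (v≡ n)) (sym (combo-+ k L M (λ i → A (n + i))))

  span-scale : ∀ {k v} c → Spanned k v → Spanned k (λ n → c *ℤ v n)
  span-scale {k} c (L , v≡) = (λ i → c *ℤ L i) ,
    λ n → trans (cong (c *ℤ_) (v≡ n)) (sym (combo-scale k c L (λ i → A (n + i))))

  span-- : ∀ {k u v} → Spanned k u → Spanned k v → Spanned k (λ n → u n -ℤ v n)
  span-- {u = u} {v} su sv = span-cong (λ n → subtraction (u n) (v n)) (span-+ su (span-scale (-ℤ + 1) sv))
    where
    subtraction : ∀ (x y : ℤ) → x +ℤ (-ℤ + 1) *ℤ y ≡ x -ℤ y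
    subtraction = solve-∀

  span-widen : ∀ {k v} → Spanned k v → Spanned (suc k) v
  span-widen {k} (L , v≡) = padEnd k L , λ n → trans (v≡ n) (sym (combo-padEnd k L (λ i → A (n + i))))

  span-shift : ∀ {k v} → Spanned k v → Spanned (suc k) (λ n → v (suc n))
  span-shift {k} {v} (L , v≡) = padFront k L , λ n → begin
      v (suc n)
    ≡⟨ v≡ (suc n) ⟩
      combo k L (λ i → A (suc n + i))
    ≡⟨ combo-cong k L (λ i → cong A (sym (+-suc n i))) ⟩
      combo k L (λ i → A (n + suc i))
    ≡⟨ sym (combo-padFront k L (λ i → A (n + i))) ⟩
      combo (suc k) (padFront k L) (λ i → A (n + i)) ∎
    where open ≡-Reasoning

  span-A : ∀ j → Spanned (suc j) (λ n → A (n + j))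
  span-A zero    = (λ _ → + 1) , λ n → sym (trans (ℤₚ.+-identityʳ _) (ℤₚ.*-identityˡ _))
  span-A (suc j) = span-cong (λ n → cong A (sym (+-suc n j))) (span-shift (span-A j))

  Δ : (ℕ → ℤ) → ℕ → ℤ
  Δ u n = u (suc n) -ℤ u n

  Δ^ : ℕ → (ℕ → ℤ) → ℕ → ℤ
  Δ^ zero    u = u
  Δ^ (suc j) u = Δ^ j (Δ u)

  Δ^-outer : ∀ j u n → Δ^ (suc j) u n ≡ Δ (Δ^ j u) n
  Δ^-outer zero    u n = refl
  Δ^-outer (suc j) u n = Δ^-outer j (Δ u) n

  Δ^-cong : ∀ j {u v} → (∀ n → u n ≡ v n) → ∀ n → Δ^ j u n ≡ Δ^ j v n
  Δ^-cong zero    u≡v n = u≡v n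
  Δ^-cong (suc j) u≡v n = Δ^-cong j (λ m → cong₂ _-ℤ_ (u≡v (suc m)) (u≡v m)) n

  Δ^-linear : ∀ j u v c n → Δ^ j (λ m → u m +ℤ c *ℤ v m) n ≡ Δ^ j u n +ℤ c *ℤ Δ^ j v n
  Δ^-linear zero    u v c n = refl
  Δ^-linear (suc j) u v c n =
    trans (Δ^-cong j (λ m → Δ-linear (u (suc m)) (u m) c (v (suc m)) (v m)) n)
          (Δ^-linear j (Δ u) (Δ v) c n)
    where
    Δ-linear : ∀ (u₁ u₀ c v₁ v₀ : ℤ) → (u₁ +ℤ c *ℤ v₁) -ℤ (u₀ +ℤ c *ℤ v₀) ≡ (u₁ -ℤ u₀) +ℤ c *ℤ (v₁ -ℤ v₀)
    Δ-linear = solve-∀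

  Δ^A-leading : ∀ j → Spanned j (λ n → Δ^ j A n -ℤ A (n + j))
  Δ^A-leading zero    = span-cong (λ n → sym (ℤₚ.i≡j⇒i-j≡0 (cong A (sym (+-identityʳ n))))) span-zero
  Δ^A-leading (suc j) =
    span-cong rearrange (span-- (span-shift (Δ^A-leading j)) (span-+ (span-widen (Δ^A-leading j)) (span-A j)))
    where
    shuffle : ∀ (v₁ a₁ v₀ a₀ : ℤ) → (v₁ -ℤ a₁) -ℤ ((v₀ -ℤ a₀) +ℤ a₀) ≡ (v₁ -ℤ v₀) -ℤ a₁
    shuffle = solve-∀
    rearrange : ∀ n → (Δ^ j A (suc n) -ℤ A (suc n + j)) -ℤ ((Δ^ j A n -ℤ A (n + j)) +ℤ A (n + j))
                      ≡ Δ^ (suc j) A n -ℤ A (n + suc j)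
    rearrange n = trans (shuffle (Δ^ j A (suc n)) (A (suc n + j)) (Δ^ j A n) (A (n + j)))
      (cong₂ _-ℤ_ (sym (Δ^-outer j A n)) (cong A (sym (+-suc n j))))

  Δ^A-spanned : ∀ j → Spanned (suc j) (Δ^ j A)
  Δ^A-spanned j = span-cong (λ n → subtract-add (Δ^ j A n) (A (n + j))) (span-+ (span-widen (Δ^A-leading j)) (span-A j))
    where
    subtract-add : ∀ (x a : ℤ) → (x -ℤ a) +ℤ a ≡ x
    subtract-add = solve-∀

  recurrence : ∀ q → Spanned (suc q) (Δ^ (suc q) A) → Spanned (suc q) (λ n → A (n + suc q))
  recurrence q sΔ = span-cong (λ n → cancel (Δ^ (suc q) A n) (A (n + suc q))) (span-- sΔ (Δ^A-leading (suc q)))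
    where
    cancel : ∀ (x a : ℤ) → x -ℤ (x -ℤ a) ≡ a
    cancel = solve-∀

  module Chain (U : ℕ → ℕ → ℤ) (c : ℕ → ℤ)
               (ΔU₀ : ∀ n → Δ (U 0) n ≡ c 0 *ℤ A n)
               (ΔU : ∀ r n → Δ (U (suc r)) n ≡ U r n +ℤ c (suc r) *ℤ A n) where

    chain-spanned : ∀ r → Spanned (suc r) (Δ^ (suc r) (U r))
    chain-spanned zero    =
      span-cong (λ n → trans (cong (λ m → c 0 *ℤ A m) (+-identityʳ n)) (sym (ΔU₀ n))) (span-scale (c 0) (span-A 0))
    chain-spanned (suc r) = span-cong lower
      (span-+ (span-widen (chain-spanned r)) (span-scale (c (suc r)) (Δ^A-spanned (suc r))))
      where
      lower : ∀ n → Δ^ (suc r) (U r) n +ℤ c (suc r) *ℤ Δ^ (suc r) A n ≡ Δ^ (suc (suc r)) (U (suc r)) n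
      lower n = sym (trans (Δ^-cong (suc r) (ΔU r) n) (Δ^-linear (suc r) (U r) A (c (suc r)) n))

-- Step 2: convolutions with the Pascal weights binom(j+p', r).

module PascalConvolution (p′ : ℕ) (g : ℕ → ℕ) where

  weight : ℕ → ℕ → ℕ
  weight r j = (j + p′) C r

  T : ℕ → ℕ → ℕ
  T r n = Σ₁ n (λ j → weight r j * g (n ∸ j))

  T₀-step : ∀ n → T 0 (suc n) ≡ weight 0 1 * g n + T 0 n
  T₀-step n = Σ₁-peel n (λ j → weight 0 j * g (suc n ∸ j))

  -- Pascal's rule binom(j+1+p', r+1) = binom(j+p', r) + binom(j+p', r+1).
  T-step : ∀ r n → T (suc r) (suc n) ≡ weight (suc r) 1 * g n + (T r n + T (suc r) n)
  T-step r n = trans (Σ₁-peel n (λ j → weight (suc r) j * g (suc n ∸ j)))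
    (cong (_+_ (weight (suc r) 1 * g n)) (trans (Σ₁-cong′ n pascal) (Σ₁-+ n _ _)))
    where
    pascal : ∀ j → weight (suc r) (suc j) * g (n ∸ j) ≡ weight r j * g (n ∸ j) + weight (suc r) j * g (n ∸ j)
    pascal j = trans (cong (_* g (n ∸ j)) (sym (nCk+nC[k+1]≡[n+1]C[k+1] (j + p′) r)))
                     (*-distribʳ-+ (g (n ∸ j)) (weight r j) (weight (suc r) j))

  A : ℕ → ℤ
  A n = + g (suc n)

  U : ℕ → ℕ → ℤ
  U r n = + T r (suc n)

  open Windows A

  ΔU₀ : ∀ n → Δ (U 0) n ≡ + weight 0 1 *ℤ A n
  ΔU₀ n = begin
      + T 0 (suc (suc n)) -ℤ U 0 n
    ≡⟨ cong (λ x → + x -ℤ U 0 n) (T₀-step (suc n)) ⟩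
      + (weight 0 1 * g (suc n) + T 0 (suc n)) -ℤ U 0 n
    ≡⟨ cong (_-ℤ U 0 n) (ℤₚ.pos-+ (weight 0 1 * g (suc n)) _) ⟩
      (+ (weight 0 1 * g (suc n)) +ℤ U 0 n) -ℤ U 0 n
    ≡⟨ add-sub (+ (weight 0 1 * g (suc n))) (U 0 n) ⟩
      + (weight 0 1 * g (suc n))
    ≡⟨ ℤₚ.pos-* (weight 0 1) (g (suc n)) ⟩
      + weight 0 1 *ℤ A n ∎
    where
    open ≡-Reasoning
    add-sub : ∀ (x y : ℤ) → (x +ℤ y) -ℤ y ≡ x
    add-sub = solve-∀

  ΔU : ∀ r n → Δ (U (suc r)) n ≡ U r n +ℤ + weight (suc r) 1 *ℤ A n
  ΔU r n = begin
      + T (suc r) (suc (suc n)) -ℤ U (suc r) n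
    ≡⟨ cong (λ x → + x -ℤ U (suc r) n) (T-step r (suc n)) ⟩
      + (weight (suc r) 1 * g (suc n) + (T r (suc n) + T (suc r) (suc n))) -ℤ U (suc r) n
    ≡⟨ cong (_-ℤ U (suc r) n) (trans (ℤₚ.pos-+ (weight (suc r) 1 * g (suc n)) _)
                                     (cong₂ _+ℤ_ (ℤₚ.pos-* (weight (suc r) 1) (g (suc n)))
                                                 (ℤₚ.pos-+ (T r (suc n)) (T (suc r) (suc n))))) ⟩
      (+ weight (suc r) 1 *ℤ A n +ℤ (U r n +ℤ U (suc r) n)) -ℤ U (suc r) n
    ≡⟨ add-sub (+ weight (suc r) 1 *ℤ A n) (U r n) (U (suc r) n) ⟩
      U r n +ℤ + weight (suc r) 1 *ℤ A n ∎
    where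
    open ≡-Reasoning
    add-sub : ∀ (x y z : ℤ) → (x +ℤ (y +ℤ z)) -ℤ z ≡ y +ℤ x
    add-sub = solve-∀

  open Chain U (λ r → + weight r 1) ΔU₀ ΔU

  recurrence-of-fixpoint : ∀ q → (∀ n → g (suc n) ≡ T q (suc n)) →
                           Spanned (suc q) (λ n → A (n + suc q))
  recurrence-of-fixpoint q g≡T =
    recurrence q (span-cong (Δ^-cong (suc q) (λ n → cong +_ (sym (g≡T n)))) (chain-spanned q))

-- The sequence c(n+1) = C^{(b)}(n+1), b_j = binom(j+p', q), satisfies a linear
-- recurrence of order q+1: b_j is the q-th Pascal weight, so step 1 reads
-- c = T_q on positive arguments.
composition-recurrence : ∀ p′ q →
  Windows.Spanned (λ n → + compAll (bPQ (suc p′) q) (suc n)) (suc q)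
                  (λ n → + compAll (bPQ (suc p′) q) (suc (n + suc q)))
composition-recurrence p′ q = recurrence-of-fixpoint q total≡T
  where
  open Compositions (bPQ (suc p′) q)
  open PascalConvolution p′ total
  total≡T : ∀ n → total (suc n) ≡ T q (suc n)
  total≡T n = trans (total-conv n) (Σ₁-cong′ (suc n) (λ j → cong (_* total (suc n ∸ j)) (b≡weight j)))
    where
    b≡weight : ∀ j → bPQ (suc p′) q j ≡ weight q j
    b≡weight j = cong (λ x → (x ∸ 1) C q) (+-suc j p′)

-- The theorem, for p = p′+1: the recurrence above, reindexed, holds even
-- for n ≥ 1.
proposition11 : (p q : ℕ) → 1 ≤ p → 1 ≤ q →
    ∃ λ (m : Fin (suc q) → ℤ) →
    (n : ℕ) → 2 ≤ n →
    + compAll (bPQ p q) (n + q + 1)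
    ≡ foldr _+ℤ_ (+ 0) (λ i → m i *ℤ + compAll (bPQ p q) (n + toℕ i))
proposition11 (suc p′) q _ _ = m , λ { (suc n) _ → trans (cong (λ x → + compAll b x) (index n)) (rec n) }
  where
  b : ℕ → ℕ
  b = bPQ (suc p′) q
  m : Fin (suc q) → ℤ
  m = proj₁ (composition-recurrence p′ q)
  rec : ∀ n → + compAll b (suc (n + suc q)) ≡ combo (suc q) m (λ i → + compAll b (suc (n + i)))
  rec = proj₂ (composition-recurrence p′ q)
  index : ∀ n → suc n + q + 1 ≡ suc (n + suc q)
  index n = trans (+-assoc (suc n) q 1) (cong (λ x → suc (n + x)) (+-comm q 1))
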